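{- Let $G$ be a disconnected finite simple graph. Then $F^-(G)=1$ if and only if $G=2K_1$ (the graph consisting of two isolated vertices).
   Context: Graphs are finite and simple. Skew zero forcing: given a set $S\subseteq V(G)$ of colored vertices, the skew forcing rule says that if some vertex $v\in V(G)$ (colored or not) has exactly one neighbor $u$ not in $S$, then $u$ is added to $S$. A set $S$ is a failed skew zero forcing set if repeated application of this rule starting from $S$ does not result in all vertices of $G$ being in $S$. The failed skew zero forcing number $F^-(G)$ is the maximum cardinality of a failed skew zero forcing set of $G$. -}

module Defs where

open import Data.Nat using (ℕ; _≤_)
open import Data.Fin using (Fin)
open import Data.Fin.Subset using (Subset; _∈_; _∉_; _∪_; ⁅_⁆; ⊤; ∣_∣)
open import Data.Product using (Σ; _×_; ∃-syntax)
open import Relation.Nullary using (¬_; Dec)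
open import Relation.Binary.PropositionalEquality using (_≡_)
open import Relation.Binary.Construct.Closure.ReflexiveTransitive using (Star)

record Graph (n : ℕ) : Set₁ where
  field
    Adj     : Fin n → Fin n → Set
    adj-sym : ∀ {u v} → Adj u v → Adj v u
    irrefl  : ∀ {u} → ¬ Adj u u
    adj-dec : ∀ u v → Dec (Adj u v)
open Graph public

Connected : ∀ {n} → Graph n → Set
Connected G = ∀ u v → Star (Adj G) u v

Disconnected : ∀ {n} → Graph n → Set
Disconnected G = ¬ Connected G

UniqueWhiteNeighbour : ∀ {n} → Graph n → Subset n → Fin n → Fin n → Set
UniqueWhiteNeighbour G S v u =
  Adj G v u × u ∉ S × (∀ w → Adj G v w → w ∉ S → w ≡ u)

-- One application of the skew forcing rule: some vertex v (coloured or not)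
-- has exactly one neighbour u not in S, and u is added to S.
data SkewForce {n} (G : Graph n) : Subset n → Subset n → Set where
  force : ∀ {S} v u → UniqueWhiteNeighbour G S v u → SkewForce G S (S ∪ ⁅ u ⁆)

FailedSkewZF : ∀ {n} → Graph n → Subset n → Set
FailedSkewZF G S = ¬ Star (SkewForce G) S ⊤

FailedSkewZFNumber : ∀ {n} → Graph n → ℕ → Set
FailedSkewZFNumber {n} G k =
  (∃[ S ] (FailedSkewZF G S × ∣ S ∣ ≡ k)) ×
  (∀ (S : Subset n) → FailedSkewZF G S → ∣ S ∣ ≤ k)

Is2K1 : ∀ {n} → Graph n → Set
Is2K1 {n} G = n ≡ 2 × (∀ u v → ¬ Adj G u v)

{-# OPTIONS --safe #-}
-- If x is isolated, no vertex can ever see the white vertex x,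
-- so V ∖ {x} is a failed set; hence F⁻(G) = 1 forces n ≤ 2 as soon as G has
-- an isolated vertex. Conversely, let F⁻(G) = 1 and let {s} be failed. If s
-- had a neighbour t, take the component A of s and a vertex z ∉ A. The sets
-- {s} ∪ (V ∖ A) ∋ s, z and {s} ∪ A ∋ s, t are too large to fail, and forcing
-- happens independently inside A and outside it: running the forcing of
-- {s} ∪ (V ∖ A) restricted to {s} ∪ A colours A, and then the forcing of
-- {s} ∪ A finishes. So {s} would not fail; thus s is isolated, V ∖ {s} has at
-- most one vertex, and G = 2K₁.
module Submission where

open import Defs
open import Data.Nat using (ℕ; zero; suc; _≤_; _<_; _∸_; s≤s; z≤n)
open import Data.Nat.Properties using (≤-trans; ≤-pred; ≤∧≢⇒<; <⇒≱; <-irrefl)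
open import Data.Fin using (Fin; zero; suc)
open import Data.Fin.Properties using (any?)
open import Data.Fin.Subset
open import Data.Fin.Subset.Properties
open import Data.Vec using (tabulate)
open import Data.Vec.Properties using (lookup∘tabulate; lookup⇒[]=; []=⇒lookup)
open import Data.Product using (∃; _×_; _,_; proj₁; proj₂)
open import Data.Sum using (_⊎_; inj₁; inj₂)
open import Data.Empty using (⊥-elim)
open import Relation.Nullary using (¬_; Dec; yes; no; does; ¬?)
open import Relation.Nullary.Decidable using (dec-true; decidable-stable; _×-dec_)
open import Relation.Binary.PropositionalEquality
open import Relation.Binary.Construct.Closure.ReflexiveTransitive
open import Function.Base using (_∘_)
open import Function.Bundles using (_⇔_; mk⇔)

fromDec : ∀ {n} {P : Fin n → Set} → (∀ x → Dec (P x)) → Subset n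
fromDec P? = tabulate (λ x → does (P? x))

∈-fromDec⁺ : ∀ {n} {P : Fin n → Set} (P? : ∀ x → Dec (P x)) {x} → P x → x ∈ fromDec P?
∈-fromDec⁺ P? {x} p = lookup⇒[]= x _ (trans (lookup∘tabulate _ x) (dec-true (P? x) p))

∈-fromDec⁻ : ∀ {n} {P : Fin n → Set} (P? : ∀ x → Dec (P x)) {x} → x ∈ fromDec P? → P x
∈-fromDec⁻ P? {x} x∈ with P? x | trans (sym (lookup∘tabulate _ x)) ([]=⇒lookup x∈)
... | yes p | _  = p
... | no _  | ()

0<∣p∣⇒Nonempty : ∀ {n} {p : Subset n} → 0 < ∣ p ∣ → Nonempty p
0<∣p∣⇒Nonempty {n} {p} 0<∣p∣ with nonempty? p
... | yes ne = ne
... | no ¬ne = ⊥-elim (<-irrefl (sym ∣p∣≡0) 0<∣p∣)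
  where
    ∣p∣≡0 : ∣ p ∣ ≡ 0
    ∣p∣≡0 = trans (cong ∣_∣ (Empty-unique ¬ne)) (∣⊥∣≡0 n)

x≢y⇒2≤∣p∣ : ∀ {n} {p : Subset n} {x y} → x ≢ y → x ∈ p → y ∈ p → 2 ≤ ∣ p ∣
x≢y⇒2≤∣p∣ {p = p} {x} {y} x≢y x∈p y∈p =
  ≤-trans (s≤s (subst (_≤ ∣ p - x ∣) (∣⁅x⁆∣≡1 y) (p⊆q⇒∣p∣≤∣q∣ ⁅y⁆⊆p-x))) (x∈p⇒∣p-x∣<∣p∣ x∈p)
  where
    ⁅y⁆⊆p-x : ⁅ y ⁆ ⊆ p - x
    ⁅y⁆⊆p-x z∈ = subst (_∈ p - x) (sym (x∈⁅y⁆⇒x≡y y z∈)) (x∈p∧x≢y⇒x∈p-y y∈p (x≢y ∘ sym))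

⁅x⁆∩p≡⁅x⁆ : ∀ {n} {p : Subset n} {x} → x ∈ p → ⁅ x ⁆ ∩ p ≡ ⁅ x ⁆
⁅x⁆∩p≡⁅x⁆ {p = p} {x} x∈p = ⊆-antisym (p∩q⊆p _ p)
  (λ y∈ → x∈p∩q⁺ (y∈ , subst (_∈ p) (sym (x∈⁅y⁆⇒x≡y x y∈)) x∈p))

module _ {n : ℕ} (G : Graph n) where

  Adj⇒≢ : ∀ {x y} → Adj G x y → x ≢ y
  Adj⇒≢ {x} xy refl = irrefl G xy

  Stalled : Subset n → Set
  Stalled S = ∀ v u → ¬ UniqueWhiteNeighbour G S v u

  stalled⇒failed : ∀ {S} x → x ∉ S → Stalled S → FailedSkewZF G S
  stalled⇒failed {S} x x∉S stalled forcing = x∉S (subst (x ∈_) (sym (stays forcing)) ∈⊤)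
    where
      stays : ∀ {T} → Star (SkewForce G) S T → S ≡ T
      stays ε                  = refl
      stays (force v u w ◅ _) = ⊥-elim (stalled v u w)

  isolated⇒∁⁅x⁆-failed : ∀ {x} → (∀ v → ¬ Adj G v x) → FailedSkewZF G (∁ ⁅ x ⁆)
  isolated⇒∁⁅x⁆-failed {x} isolated = stalled⇒failed x (x∈p⇒x∉∁p (x∈⁅x⁆ x))
    λ v u (vu , u∉ , _) → isolated v (subst (Adj G v) (x∈⁅y⁆⇒x≡y x (x∉∁p⇒x∈p u∉)) vu)

  failed⇒∣S∣<n : ∀ {S} → FailedSkewZF G S → ∣ S ∣ < n
  failed⇒∣S∣<n {S} failed = ≤∧≢⇒< (∣p∣≤n S)
    λ ∣S∣≡n → failed (subst (λ T → Star (SkewForce G) T ⊤) (sym (∣p∣≡n⇒p≡⊤ ∣S∣≡n)) ε)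

  SkewForce⇒⊆ : ∀ {S T} → SkewForce G S T → S ⊆ T
  SkewForce⇒⊆ (force _ u _) = p⊆p∪q ⁅ u ⁆

  Closed : Subset n → Set
  Closed A = ∀ {v w} → Adj G v w → v ∈ A → w ∈ A

  -- While V ∖ A stays coloured, every force happens inside the closed set A,
  -- so intersecting with any B ⊇ A turns a force into a force.
  restrict-force : ∀ {A B T U} → Closed A → A ⊆ B → ∁ A ⊆ T →
                   SkewForce G T U → SkewForce G (T ∩ B) (U ∩ B)
  restrict-force {A} {B} {T} closed A⊆B ∁A⊆T (force v u (vu , u∉T , unique)) =
    subst (SkewForce G (T ∩ B)) (sym step) (force v u (vu , u∉T∩B , unique′))
    where
      u∈A : u ∈ A
      u∈A = x∉∁p⇒x∈p (λ u∈∁A → u∉T (∁A⊆T u∈∁A))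
      v∈A : v ∈ A
      v∈A = closed (adj-sym G vu) u∈A
      u∉T∩B : u ∉ T ∩ B
      u∉T∩B u∈ = u∉T (proj₁ (x∈p∩q⁻ T B u∈))
      unique′ : ∀ w → Adj G v w → w ∉ T ∩ B → w ≡ u
      unique′ w vw w∉ = unique w vw λ w∈T → w∉ (x∈p∩q⁺ (w∈T , A⊆B (closed vw v∈A)))
      step : (T ∪ ⁅ u ⁆) ∩ B ≡ (T ∩ B) ∪ ⁅ u ⁆
      step = trans (∩-distribʳ-∪ B T ⁅ u ⁆) (cong (T ∩ B ∪_) (⁅x⁆∩p≡⁅x⁆ (A⊆B u∈A)))

  restrict-forces : ∀ {A B T U} → Closed A → A ⊆ B → ∁ A ⊆ T →
                    Star (SkewForce G) T U → Star (SkewForce G) (T ∩ B) (U ∩ B)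
  restrict-forces closed A⊆B ∁A⊆T ε = ε
  restrict-forces closed A⊆B ∁A⊆T (f ◅ fs) =
    restrict-force closed A⊆B ∁A⊆T f ◅ restrict-forces closed A⊆B (⊆-trans ∁A⊆T (SkewForce⇒⊆ f)) fs

  forces-split : ∀ {A S} → Closed A → Star (SkewForce G) (S ∪ ∁ A) ⊤ →
                 Star (SkewForce G) (S ∪ A) ⊤ → Star (SkewForce G) S ⊤
  forces-split {A} {S} closed from-S∪∁A from-S∪A =
    subst₂ (Star (SkewForce G)) restrict-start (∩-identityˡ (S ∪ A))
      (restrict-forces closed (q⊆p∪q S A) (q⊆p∪q S (∁ A)) from-S∪∁A) ◅◅ from-S∪A
    where
      open ≡-Reasoning
      restrict-start : (S ∪ ∁ A) ∩ (S ∪ A) ≡ S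
      restrict-start = begin
        (S ∪ ∁ A) ∩ (S ∪ A) ≡⟨ sym (∪-distribˡ-∩ S (∁ A) A) ⟩
        S ∪ (∁ A ∩ A)       ≡⟨ cong (S ∪_) (∩-inverseˡ A) ⟩
        S ∪ ⊥               ≡⟨ ∪-identityʳ S ⟩
        S                   ∎

  Adjacent-to : Subset n → Fin n → Set
  Adjacent-to R w = ∃ λ v → v ∈ R × Adj G v w

  adjacent-to? : ∀ R w → Dec (Adjacent-to R w)
  adjacent-to? R w = any? λ v → (v ∈? R) ×-dec adj-dec G v w

  neighbours : Subset n → Subset n
  neighbours R = fromDec (adjacent-to? R)

  ∈-neighbours⁺ : ∀ {R v w} → v ∈ R → Adj G v w → w ∈ neighbours R
  ∈-neighbours⁺ v∈R vw = ∈-fromDec⁺ (adjacent-to? _) (_ , v∈R , vw)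

  ∈-neighbours⁻ : ∀ {R w} → w ∈ neighbours R → Adjacent-to R w
  ∈-neighbours⁻ {R} = ∈-fromDec⁻ (adjacent-to? R)

  grow : Subset n → Subset n
  grow R = R ∪ neighbours R

  closed-or-grows : ∀ R → Closed R ⊎ R ⊂ grow R
  closed-or-grows R with R ⊂? grow R
  ... | yes R⊂ = inj₂ R⊂
  ... | no ¬R⊂ = inj₁ λ {v} {w} vw v∈R → decidable-stable (w ∈? R) λ w∉R →
          ¬R⊂ (p⊆p∪q _ , w , x∈p∪q⁺ (inj₂ (∈-neighbours⁺ v∈R vw)) , w∉R)

  reach : Fin n → ℕ → Subset n
  reach s zero    = ⁅ s ⁆
  reach s (suc k) = grow (reach s k)

  s∈reach : ∀ s k → s ∈ reach s k
  s∈reach s zero    = x∈⁅x⁆ s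
  s∈reach s (suc k) = x∈p∪q⁺ (inj₁ (s∈reach s k))

  reach⇒walk : ∀ s k {w} → w ∈ reach s k → Star (Adj G) s w
  reach⇒walk s zero w∈ = subst (Star (Adj G) s) (sym (x∈⁅y⁆⇒x≡y s w∈)) ε
  reach⇒walk s (suc k) w∈ with x∈p∪q⁻ (reach s k) _ w∈
  ... | inj₁ w∈reach = reach⇒walk s k w∈reach
  ... | inj₂ w∈nbrs with ∈-neighbours⁻ w∈nbrs
  ...   | v , v∈reach , vw = reach⇒walk s k v∈reach ◅◅ (vw ◅ ε)

  reach-closes-or-grows : ∀ s k → (∃ λ j → Closed (reach s j)) ⊎ k < ∣ reach s k ∣
  reach-closes-or-grows s zero = inj₂ (subst (0 <_) (sym (∣⁅x⁆∣≡1 s)) (s≤s z≤n))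
  reach-closes-or-grows s (suc k) with reach-closes-or-grows s k | closed-or-grows (reach s k)
  ... | inj₁ closes | _          = inj₁ closes
  ... | inj₂ _      | inj₁ closed = inj₁ (k , closed)
  ... | inj₂ k<∣R∣  | inj₂ R⊂     = inj₂ (≤-trans (s≤s k<∣R∣) (p⊂q⇒∣p∣<∣q∣ R⊂))

  component : ∀ s → ∃ λ A → Closed A × s ∈ A × (∀ {w} → w ∈ A → Star (Adj G) s w)
  component s with reach-closes-or-grows s n
  ... | inj₁ (j , closed) = reach s j , closed , s∈reach s j , reach⇒walk s j
  ... | inj₂ n<∣R∣        = ⊥-elim (<⇒≱ n<∣R∣ (∣p∣≤n (reach s n)))

  disconnected⇒proper-closed : Disconnected G → ∀ s →
                               ∃ λ A → Closed A × s ∈ A × ∃ λ z → z ∉ A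
  disconnected⇒proper-closed D s with component s
  ... | A , closed , s∈A , walk with any? (λ z → ¬? (z ∈? A))
  ...   | yes z∉A = A , closed , s∈A , z∉A
  ...   | no ¬z∉A = ⊥-elim (D λ u v → reverse (adj-sym G) (walk (∈A u)) ◅◅ walk (∈A v))
    where
      ∈A : ∀ z → z ∈ A
      ∈A z = decidable-stable (z ∈? A) λ z∉A → ¬z∉A (z , z∉A)

  module _ (F⁻≤1 : ∀ S → FailedSkewZF G S → ∣ S ∣ ≤ 1) where

    distinct⇒¬failed : ∀ {S x y} → x ≢ y → x ∈ S → y ∈ S → ¬ FailedSkewZF G S
    distinct⇒¬failed x≢y x∈S y∈S failed = <⇒≱ (x≢y⇒2≤∣p∣ x≢y x∈S y∈S) (F⁻≤1 _ failed)

    non-isolated⇒¬failed : Disconnected G → ∀ {S s t} → Adj G s t → s ∈ S → ¬ FailedSkewZF G S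
    non-isolated⇒¬failed D {s = s} st s∈S failed
      with disconnected⇒proper-closed D s
    ... | A , closed , s∈A , z , z∉A =
      distinct⇒¬failed s≢z (x∈p∪q⁺ (inj₁ s∈S)) (x∈p∪q⁺ (inj₂ (x∉p⇒x∈∁p z∉A))) λ from-S∪∁A →
      distinct⇒¬failed (Adj⇒≢ st) (x∈p∪q⁺ (inj₁ s∈S)) (x∈p∪q⁺ (inj₂ (closed st s∈A))) λ from-S∪A →
      failed (forces-split closed from-S∪∁A from-S∪A)
      where
        s≢z : s ≢ z
        s≢z refl = z∉A s∈A

  F⁻≡1⇒2K₁ : Disconnected G → FailedSkewZFNumber G 1 → Is2K1 G
  F⁻≡1⇒2K₁ D ((S , failed , ∣S∣≡1) , F⁻≤1) = n≡2 , edgeless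
    where
      s∈S : ∃ λ s → s ∈ S
      s∈S = 0<∣p∣⇒Nonempty (subst (0 <_) (sym ∣S∣≡1) (s≤s z≤n))
      s : Fin n
      s = proj₁ s∈S
      isolated : ∀ v → ¬ Adj G v s
      isolated v vs = non-isolated⇒¬failed F⁻≤1 D (adj-sym G vs) (proj₂ s∈S) failed
      others-fail : FailedSkewZF G (∁ ⁅ s ⁆)
      others-fail = isolated⇒∁⁅x⁆-failed isolated
      edgeless : ∀ x y → ¬ Adj G x y
      edgeless x y xy = distinct⇒¬failed F⁻≤1 (Adj⇒≢ xy)
        (x∉p⇒x∈∁p (x≢y⇒x∉⁅y⁆ λ { refl → isolated y (adj-sym G xy) }))
        (x∉p⇒x∈∁p (x≢y⇒x∉⁅y⁆ λ { refl → isolated x xy }))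
        others-fail
      1<m⇒m∸1≤1⇒m≡2 : ∀ m → 1 < m → m ∸ 1 ≤ 1 → m ≡ 2
      1<m⇒m∸1≤1⇒m≡2 (suc zero)          (s≤s ()) _
      1<m⇒m∸1≤1⇒m≡2 (suc (suc zero))    _ _           = refl
      1<m⇒m∸1≤1⇒m≡2 (suc (suc (suc _))) _ (s≤s ())
      n≡2 : n ≡ 2
      n≡2 = 1<m⇒m∸1≤1⇒m≡2 n (subst (_< n) ∣S∣≡1 (failed⇒∣S∣<n failed))
        (subst (_≤ 1) (trans (∣∁p∣≡n∸∣p∣ ⁅ s ⁆) (cong (n ∸_) (∣⁅x⁆∣≡1 s))) (F⁻≤1 _ others-fail))

  2K₁⇒F⁻≡1 : Is2K1 G → FailedSkewZFNumber G 1
  2K₁⇒F⁻≡1 (refl , edgeless) =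
    (⁅ zero ⁆ , ⁅0⁆-fails , ∣⁅x⁆∣≡1 (zero {1})) , λ S failed → ≤-pred (failed⇒∣S∣<n failed)
    where
      ⁅0⁆-fails : FailedSkewZF G ⁅ zero ⁆
      ⁅0⁆-fails = stalled⇒failed (suc zero) (x≢y⇒x∉⁅y⁆ {y = zero} λ ())
        λ v u uwn → edgeless v u (proj₁ uwn)

theorem3p1 : ∀ (n : ℕ) (G : Graph n) → Disconnected G →
    (FailedSkewZFNumber G 1 ⇔ Is2K1 G)
theorem3p1 n G D = mk⇔ (F⁻≡1⇒2K₁ G D) (2K₁⇒F⁻≡1 G)
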